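{- Let $G=(V,E)$ be a circle graph given by an interval representation as in the context. Given a vector $x=(x^i_j)_{(i,j)\in A}\in\{0,1\}^A$ and a positive integer $c$, the constraints \[ M x_0\le c\mathbf 1,\qquad M_i x_i\le\mathbf 1\ (\forall i\in V^{\bullet}),\qquad \sum_{i:(i,j)\in A}x^i_j=1\ (\forall j\in V) \] are all satisfied if and only if $T=\{(i,j)\in A: x^i_j=1\}$ is an arborescence of $\Gamma$ satisfying (C1) for each $i\in V$, $\mathrm{Ch}(T,i)$ is a chain of $(V,\preceq)$ or the empty set, and (C2) every antichain of $(V,\preceq)$ contained in $\mathrm{Ch}(T,0)$ has size at most $c$.
   Context: $V$ is a finite nonempty set; for each $j\in V$, $I(j)=[l_j,r_j]\subseteq\mathbb R$ with $l_j<r_j$, all $2|V|$ endpoints pairwise distinct; $G=(V,E)$ has $\{i,j\}\in E$ ($i\ne j$) iff $I(i)\cap I(j)\ne\emptyset$ and neither interval contains the other. Partial order: $i\preceq j$ iff $i=j$ or $r_i\le l_j$. Let $0\notin V$ be a root and $\Gamma$ the directed graph on $V\cup\{0\}$ with arc set $A=\{(0,i):i\in V\}\cup\{(i,j):I(i)\supsetneq I(j)\}$. An arborescence is $T\subseteq A$ with $|T|=|V|$ in which every $i\in V$ has exactly one incoming arc; $\mathrm{Ch}(T,i)=\{j:(i,j)\in T\}$. For $i\in V\cup\{0\}$, $V_i=\{j\in V:(i,j)\in A\}$; $V^{\bullet}=\{i\in V:V_i\neq\emptyset\}$; $x_i=(x^i_j)_{j\in V_i}$. $P$ is the set of the $2|V|$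 endpoints, $M$ the $P\times V$ $0$-$1$ matrix with $m_{pi}=1$ iff $p\in I(i)$, $M_i$ its submatrix of columns indexed by $V_i$; $\mathbf 1$ is an all-ones vector. -}

module Defs where

open import Level using (0ℓ)
open import Data.Nat using (ℕ; zero; suc; _+_; _*_; _≤_)
open import Data.Bool using (Bool; true; false; _∧_; _∨_; T)
open import Data.Unit using (tt)
open import Data.Fin using (Fin)
import Data.Fin as Fin
open import Data.Fin.Subset using (Subset) renaming (_∈_ to _∈ₛ_; ∣_∣ to ∣_∣ₛ)
open import Data.Maybe using (Maybe; just; nothing)
open import Data.Product using (Σ; ∃; _×_; ∃!)
open import Data.Sum using (_⊎_)
open import Relation.Nullary using (¬_)
open import Relation.Nullary.Decidable using (⌊_⌋)
open import Relation.Binary.Bundles using (StrictTotalOrder)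
open import Relation.Binary.PropositionalEquality using (_≡_)

∑ : (n : ℕ) → (Fin n → ℕ) → ℕ
∑ zero    f = 0
∑ (suc n) f = f Fin.zero + ∑ n (λ i → f (Fin.suc i))

b2n : Bool → ℕ
b2n true  = 1
b2n false = 0

ext : (b : Bool) → (T b → Bool) → Bool
ext true  f = f tt
ext false f = false

-- The real line is abstracted as an arbitrary strict total order (only the order of
-- the endpoints matters in every notion used).
module Setup (O : StrictTotalOrder 0ℓ 0ℓ 0ℓ)
             (n : ℕ) (l r : Fin n → StrictTotalOrder.Carrier O) where
  open StrictTotalOrder O renaming (Carrier to ℝ)

  _≤ᵇ_ : ℝ → ℝ → Bool
  a ≤ᵇ b = ⌊ a <? b ⌋ ∨ ⌊ a ≟ b ⌋

  _<ᵇ_ : ℝ → ℝ → Bool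
  a <ᵇ b = ⌊ a <? b ⌋

  WellFormed : Set
  WellFormed = (∀ j → l j < r j)
             × (∀ i j → (l i ≈ l j → i ≡ j) × (r i ≈ r j → i ≡ j) × ¬ (l i ≈ r j))

  -- V ∪ {0}: nothing is the root 0.
  Node : Set
  Node = Maybe (Fin n)

  -- Arc set A of Γ.  I(i) ⊋ I(j); with pairwise distinct endpoints this is l_i < l_j ∧ r_j < r_i.
  arcᵇ : Node → Fin n → Bool
  arcᵇ nothing  j = true
  arcᵇ (just i) j = (l i <ᵇ l j) ∧ (r j <ᵇ r i)

  Arc : Node → Fin n → Set
  Arc i j = T (arcᵇ i j)

  ArcVec : Set
  ArcVec = (i : Node) (j : Fin n) → Arc i j → Bool

  xv : ArcVec → Node → Fin n → ℕ
  xv x i j = b2n (ext (arcᵇ i j) (x i j))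

  IsEndpoint : ℝ → Set
  IsEndpoint p = ∃ λ k → (p ≡ l k) ⊎ (p ≡ r k)

  M : ℝ → Fin n → ℕ
  M p j = b2n ((l j ≤ᵇ p) ∧ (p ≤ᵇ r j))

  -- (M_i x_i)_p = Σ_{j ∈ V_i} m_{pj} x^i_j   (also for i = root, giving M x_0)
  Mx : ArcVec → Node → ℝ → ℕ
  Mx x i p = ∑ n (λ j → M p j * xv x i j)

  Bullet : Fin n → Set
  Bullet i = ∃ λ j → Arc (just i) j

  Constraints : ℕ → ArcVec → Set
  Constraints c x =
      (∀ p → IsEndpoint p → Mx x nothing p ≤ c)
    × (∀ i → Bullet i → ∀ p → IsEndpoint p → Mx x (just i) p ≤ 1)
    × (∀ j → xv x nothing j + ∑ n (λ i → xv x (just i) j) ≡ 1)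

  InT : ArcVec → Node → Fin n → Set
  InT x i j = Σ (Arc i j) (λ a → x i j a ≡ true)

  card : ArcVec → ℕ
  card x = ∑ n (λ j → xv x nothing j) + ∑ n (λ i → ∑ n (λ j → xv x (just i) j))

  IsArborescence : ArcVec → Set
  IsArborescence x = (card x ≡ n) × (∀ j → ∃! _≡_ (λ i → InT x i j))

  _⪯_ : Fin n → Fin n → Set
  i ⪯ j = (i ≡ j) ⊎ (r i < l j ⊎ r i ≈ l j)

  Ch : ArcVec → Node → Fin n → Set
  Ch x i j = InT x i j

  C1 : ArcVec → Set
  C1 x = ∀ i → (∀ j k → Ch x (just i) j → Ch x (just i) k → (j ⪯ k) ⊎ (k ⪯ j))
                ⊎ (∀ j → ¬ Ch x (just i) j)

  IsAntichain : Subset n → Set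
  IsAntichain S = ∀ j k → j ∈ₛ S → k ∈ₛ S → j ⪯ k → j ≡ k

  C2 : ℕ → ArcVec → Set
  C2 c x = ∀ (S : Subset n) → (∀ j → j ∈ₛ S → Ch x nothing j) → IsAntichain S → ∣ S ∣ₛ ≤ c

-- Each block of constraints is a counting statement about the set T of arcs
-- selected by x.  The third block says that every j ∈ V has exactly one
-- selected incoming arc, which also forces |T| = |V|.  Since all endpoints are
-- distinct, two intervals are ⪯-comparable iff no endpoint lies in both, so
-- M_i x_i ≤ 1 says exactly that Ch(T, i) is a chain.  Finally, pairwise
-- incomparable intervals all contain the largest of their left endpoints, so
-- every antichain in Ch(T, 0) lies inside the set of root children containing
-- one endpoint, and such a set is itself an antichain whose size is the
-- corresponding entry of M x_0.
module Submission where

open import Defs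
open import Level using (0ℓ)
import Algebra.Properties.CommutativeMonoid.Sum as CommutativeMonoidSum
open import Data.Bool using (Bool; true; false; _∧_; T)
open import Data.Bool.Properties using (T-≡; T-∧; T-∨)
open import Data.Empty using (⊥-elim)
open import Data.Fin using (Fin; zero; suc)
import Data.Fin.Properties as Fin
open import Data.Fin.Subset using (Subset; inside; outside; Nonempty; Empty; ⁅_⁆)
  renaming (_∈_ to _∈ₛ_; ∣_∣ to ∣_∣ₛ)
open import Data.Fin.Subset.Properties
  using (nonempty?; Empty-unique; ∣⊥∣≡0; ∣⁅x⁆∣≡1; x∈⁅x⁆; p⊆q⇒∣p∣≤∣q∣; x∈p⇒∣p-x∣<∣p∣; x∈p∧x≢y⇒x∈p-y)
open import Data.Maybe using (Maybe; just; nothing)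
open import Data.Maybe.Properties using (just-injective)
open import Data.Nat using (ℕ; zero; suc; _+_; _*_; _≤_; z≤n; s≤s)
open import Data.Nat.Properties using (+-0-commutativeMonoid; ≤-trans; ≤-reflexive; ≤-antisym)
open import Data.Product using (_×_; _,_; proj₁; proj₂; ∃; ∃!)
open import Data.Product.Function.NonDependent.Propositional using (_×-⇔_)
open import Data.Sum using (_⊎_; inj₁; inj₂; [_,_])
open import Data.Sum.Function.Propositional using (_⊎-⇔_)
open import Data.Vec using (tabulate; _∷_; here; there)
open import Data.Vec.Properties using (lookup∘tabulate; []=⇒lookup; lookup⇒[]=)
open import Function using (_∘_; id)
open import Function.Bundles using (_⇔_; mk⇔; Equivalence)
open import Function.Properties.Equivalence using () renaming (trans to ⇔-trans)
open import Relation.Binary.Bundles using (StrictTotalOrder; TotalPreorder)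
open import Relation.Binary.Definitions using (tri<; tri≈; tri>)
import Relation.Binary.Properties.StrictTotalOrder as StrictTotalOrderProperties
open import Relation.Nullary using (¬_; yes; no; contradiction)
open import Relation.Nullary.Decidable using (Dec; ⌊_⌋; toWitness; fromWitness)
open import Relation.Binary.PropositionalEquality
  using (_≡_; refl; sym; trans; cong; cong₂; subst; module ≡-Reasoning)

open Equivalence using (to; from)
open CommutativeMonoidSum +-0-commutativeMonoid using (sum; sum-cong-≗) renaming (∑-comm to sum-comm)

∑≡sum : ∀ n (f : Fin n → ℕ) → ∑ n f ≡ sum f
∑≡sum zero    f = refl
∑≡sum (suc n) f = cong (f zero +_) (∑≡sum n (f ∘ suc))

∑-cong : ∀ n {f g : Fin n → ℕ} → (∀ i → f i ≡ g i) → ∑ n f ≡ ∑ n g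
∑-cong zero    f≗g = refl
∑-cong (suc n) f≗g = cong₂ _+_ (f≗g zero) (∑-cong n (f≗g ∘ suc))

∑-comm : ∀ m n (F : Fin m → Fin n → ℕ) →
         ∑ m (λ i → ∑ n (F i)) ≡ ∑ n (λ j → ∑ m (λ i → F i j))
∑-comm m n F = begin
  ∑ m (λ i → ∑ n (F i))          ≡⟨ ∑≡sum m _ ⟩
  sum (λ i → ∑ n (F i))          ≡⟨ sum-cong-≗ (λ i → ∑≡sum n (F i)) ⟩
  sum (λ i → sum (F i))          ≡⟨ sum-comm F ⟩
  sum (λ j → sum (λ i → F i j))  ≡⟨ sum-cong-≗ (λ j → ∑≡sum m (λ i → F i j)) ⟨
  sum (λ j → ∑ m (λ i → F i j))  ≡⟨ ∑≡sum n _ ⟨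
  ∑ n (λ j → ∑ m (λ i → F i j))  ∎
  where open ≡-Reasoning

∑-const-1 : ∀ n → ∑ n (λ _ → 1) ≡ n
∑-const-1 zero    = refl
∑-const-1 (suc n) = cong suc (∑-const-1 n)

b2n-∧ : ∀ a b → b2n a * b2n b ≡ b2n (a ∧ b)
b2n-∧ true  true  = refl
b2n-∧ true  false = refl
b2n-∧ false _     = refl

T-ext : ∀ b (f : T b → Bool) → T (ext b f) ⇔ ∃ λ t → f t ≡ true
T-ext true  f = mk⇔ (λ t → _ , to T-≡ t) (λ (_ , e) → from T-≡ e)
T-ext false f = mk⇔ (λ ()) (λ ())

∣tabulate∣≡∑ : ∀ n (f : Fin n → Bool) → ∣ tabulate f ∣ₛ ≡ ∑ n (b2n ∘ f)
∣tabulate∣≡∑ zero    f = refl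
∣tabulate∣≡∑ (suc n) f with f zero
... | true  = cong suc (∣tabulate∣≡∑ n (f ∘ suc))
... | false = ∣tabulate∣≡∑ n (f ∘ suc)

∈-tabulate : ∀ {n} {f : Fin n → Bool} {j} → j ∈ₛ tabulate f ⇔ T (f j)
∈-tabulate {f = f} {j} = mk⇔
  (λ j∈ → from T-≡ (trans (sym (lookup∘tabulate f j)) ([]=⇒lookup j∈)))
  (λ t → lookup⇒[]= j _ (trans (lookup∘tabulate f j) (to T-≡ t)))

module _ {n : ℕ} {p : Subset n} where

  Empty⇒∣p∣≡0 : Empty p → ∣ p ∣ₛ ≡ 0
  Empty⇒∣p∣≡0 ∅ = trans (cong ∣_∣ₛ (Empty-unique ∅)) (∣⊥∣≡0 n)

  ∈⇒1≤∣p∣ : ∀ {j} → j ∈ₛ p → 1 ≤ ∣ p ∣ₛ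
  ∈⇒1≤∣p∣ j∈p = ≤-trans (s≤s z≤n) (x∈p⇒∣p-x∣<∣p∣ j∈p)

  ∣p∣≤1⇔ : ∣ p ∣ₛ ≤ 1 ⇔ (∀ {j k} → j ∈ₛ p → k ∈ₛ p → j ≡ k)
  ∣p∣≤1⇔ = mk⇔ atMostOne sizeBound
    where
    atMostOne : ∣ p ∣ₛ ≤ 1 → ∀ {j k} → j ∈ₛ p → k ∈ₛ p → j ≡ k
    atMostOne ∣p∣≤1 {j} {k} j∈p k∈p with k Fin.≟ j
    ... | yes k≡j = sym k≡j
    ... | no  k≢j = contradiction
      (≤-trans (s≤s (x∈p⇒∣p-x∣<∣p∣ (x∈p∧x≢y⇒x∈p-y k∈p k≢j))) (≤-trans (x∈p⇒∣p-x∣<∣p∣ j∈p) ∣p∣≤1))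
      (λ { (s≤s ()) })

    sizeBound : (∀ {j k} → j ∈ₛ p → k ∈ₛ p → j ≡ k) → ∣ p ∣ₛ ≤ 1
    sizeBound unique with nonempty? p
    ... | no  ∅          = subst (_≤ 1) (sym (Empty⇒∣p∣≡0 ∅)) z≤n
    ... | yes (j , j∈p)  = ≤-trans (p⊆q⇒∣p∣≤∣q∣ p⊆⁅j⁆) (≤-reflexive (∣⁅x⁆∣≡1 j))
      where
      p⊆⁅j⁆ : ∀ {k} → k ∈ₛ p → k ∈ₛ ⁅ j ⁆
      p⊆⁅j⁆ k∈p = subst (_∈ₛ ⁅ j ⁆) (unique j∈p k∈p) (x∈⁅x⁆ j)

  ∣p∣≡1⇔∃! : ∣ p ∣ₛ ≡ 1 ⇔ ∃! _≡_ (_∈ₛ p)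
  ∣p∣≡1⇔∃! = mk⇔ unique size
    where
    unique : ∣ p ∣ₛ ≡ 1 → ∃! _≡_ (_∈ₛ p)
    unique ∣p∣≡1 with nonempty? p
    ... | no  ∅         = contradiction (trans (sym (Empty⇒∣p∣≡0 ∅)) ∣p∣≡1) (λ ())
    ... | yes (j , j∈p) = j , j∈p , to ∣p∣≤1⇔ (≤-reflexive ∣p∣≡1) j∈p

    size : ∃! _≡_ (_∈ₛ p) → ∣ p ∣ₛ ≡ 1
    size (j , j∈p , unique) =
      ≤-antisym (from ∣p∣≤1⇔ (λ a b → trans (sym (unique a)) (unique b))) (∈⇒1≤∣p∣ j∈p)

module _ {a ℓ₁ ℓ₂} (P : TotalPreorder a ℓ₁ ℓ₂) where
  open TotalPreorder P renaming (Carrier to A; refl to ≲-refl; trans to ≲-trans)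

  ∃-maximal : ∀ {n} (g : Fin n → A) (S : Subset n) → Nonempty S →
              ∃ λ m → m ∈ₛ S × ∀ {j} → j ∈ₛ S → g j ≲ g m
  ∃-maximal g (outside ∷ S) (suc j , there j∈S) with ∃-maximal (g ∘ suc) S (j , j∈S)
  ... | m , m∈S , max = suc m , there m∈S , λ { (there j∈S) → max j∈S }
  ∃-maximal g (inside ∷ S) _ with nonempty? S
  ... | no ∅ = zero , here , λ { here → ≲-refl ; (there j∈S) → contradiction (_ , j∈S) ∅ }
  ... | yes ne with ∃-maximal (g ∘ suc) S ne
  ...   | m , m∈S , max with total (g zero) (g (suc m))
  ...     | inj₁ g0≲gm = suc m , there m∈S , λ { here → g0≲gm ; (there j∈S) → max j∈S }
  ...     | inj₂ gm≲g0 = zero , here , λ { here → ≲-refl ; (there j∈S) → ≲-trans (max j∈S) gm≲g0 }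

∃!-cong : ∀ {a p q} {A : Set a} {P : A → Set p} {Q : A → Set q} →
          (∀ {x} → P x ⇔ Q x) → ∃! _≡_ P ⇔ ∃! _≡_ Q
∃!-cong P⇔Q = mk⇔
  (λ (x , Px , unique) → x , to P⇔Q Px , unique ∘ from P⇔Q)
  (λ (x , Qx , unique) → x , from P⇔Q Qx , unique ∘ to P⇔Q)

toMaybe : ∀ {n} → Fin (suc n) → Maybe (Fin n)
toMaybe zero    = nothing
toMaybe (suc i) = just i

toMaybe-injective : ∀ {n} {j k : Fin (suc n)} → toMaybe j ≡ toMaybe k → j ≡ k
toMaybe-injective {j = zero}  {zero}  _  = refl
toMaybe-injective {j = suc i} {suc k} eq = cong suc (just-injective eq)

∃!-toMaybe : ∀ {n p} {P : Maybe (Fin n) → Set p} → ∃! _≡_ (P ∘ toMaybe) ⇔ ∃! _≡_ P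
∃!-toMaybe {P = P} = mk⇔ to′ from′
  where
  to′ : ∃! _≡_ (P ∘ toMaybe) → ∃! _≡_ P
  to′ (k , Pk , unique) = toMaybe k , Pk , λ
    { {nothing} Py → cong toMaybe (unique {zero} Py)
    ; {just i}  Py → cong toMaybe (unique {suc i} Py)
    }

  from′ : ∃! _≡_ P → ∃! _≡_ (P ∘ toMaybe)
  from′ (nothing , Py , unique) = zero  , Py , toMaybe-injective ∘ unique
  from′ (just i  , Py , unique) = suc i , Py , toMaybe-injective ∘ unique

module Intervals (O : StrictTotalOrder 0ℓ 0ℓ 0ℓ) (n : ℕ)
                 (l r : Fin n → StrictTotalOrder.Carrier O) where
  open StrictTotalOrder O using (_≈_; _<_; _<?_; _≟_; compare; asym; irrefl; module Eq)
    renaming (Carrier to ℝ)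
  open StrictTotalOrderProperties O
    using (totalPreorder) renaming (_≤_ to _≦_; trans to ≦-trans; total to ≦-total)
  open Setup O n l r

  T-≤ᵇ : ∀ {a b} → T (a ≤ᵇ b) ⇔ a ≦ b
  T-≤ᵇ {a} {b} = ⇔-trans T-∨ (T-⌊⌋ (a <? b) ⊎-⇔ T-⌊⌋ (a ≟ b))
    where
    T-⌊⌋ : ∀ {A : Set} (a? : Dec A) → T ⌊ a? ⌋ ⇔ A
    T-⌊⌋ a? = mk⇔ (toWitness {a? = a?}) fromWitness

  ≦⇒≯ : ∀ {a b} → a ≦ b → ¬ (b < a)
  ≦⇒≯ (inj₁ a<b) = asym a<b
  ≦⇒≯ (inj₂ a≈b) = irrefl (Eq.sym a≈b)

  _∈I_ : ℝ → Fin n → Set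
  p ∈I j = l j ≦ p × p ≦ r j

  ⪯⊎l∈I : ∀ j k → l j ≦ l k → j ⪯ k ⊎ l k ∈I j
  ⪯⊎l∈I j k lj≦lk with compare (l k) (r j)
  ... | tri< lk<rj _ _ = inj₂ (lj≦lk , inj₁ lk<rj)
  ... | tri≈ _ lk≈rj _ = inj₁ (inj₂ (inj₂ (Eq.sym lk≈rj)))
  ... | tri> _ _ rj<lk = inj₁ (inj₂ (inj₁ rj<lk))

  inTᵇ : ArcVec → Node → Fin n → Bool
  inTᵇ x i j = ext (arcᵇ i j) (x i j)

  childrenContaining : ArcVec → Node → ℝ → Subset n
  childrenContaining x i p = tabulate (λ j → ((l j ≤ᵇ p) ∧ (p ≤ᵇ r j)) ∧ inTᵇ x i j)

  ∈-childrenContaining : ∀ x i p {j} → j ∈ₛ childrenContaining x i p ⇔ (p ∈I j × InT x i j)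
  ∈-childrenContaining x i p {j} =
    ⇔-trans ∈-tabulate (⇔-trans T-∧ ((⇔-trans T-∧ (T-≤ᵇ ×-⇔ T-≤ᵇ)) ×-⇔ T-ext (arcᵇ i j) (x i j)))

  Mx≡∣childrenContaining∣ : ∀ x i p → Mx x i p ≡ ∣ childrenContaining x i p ∣ₛ
  Mx≡∣childrenContaining∣ x i p = trans
    (∑-cong n (λ j → b2n-∧ ((l j ≤ᵇ p) ∧ (p ≤ᵇ r j)) (inTᵇ x i j)))
    (sym (∣tabulate∣≡∑ n _))

  parents : ArcVec → Fin n → Subset (suc n)
  parents x j = tabulate (λ k → inTᵇ x (toMaybe k) j)

  ∈-parents : ∀ {x j k} → k ∈ₛ parents x j ⇔ InT x (toMaybe k) j
  ∈-parents {x} {j} {k} =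
    ⇔-trans (∈-tabulate {f = λ k → inTᵇ x (toMaybe k) j}) (T-ext (arcᵇ (toMaybe k) j) (x (toMaybe k) j))

  uniqueParent⇔ : ∀ x j →
    (xv x nothing j + ∑ n (λ i → xv x (just i) j) ≡ 1) ⇔ ∃! _≡_ (λ i → InT x i j)
  uniqueParent⇔ x j =
    ⇔-trans (mk⇔ (trans count) (trans (sym count)))
    (⇔-trans (∣p∣≡1⇔∃! {p = parents x j})
    (⇔-trans (∃!-cong (∈-parents {x} {j})) ∃!-toMaybe))
    where
    count : ∣ parents x j ∣ₛ ≡ xv x nothing j + ∑ n (λ i → xv x (just i) j)
    count = ∣tabulate∣≡∑ (suc n) (λ k → inTᵇ x (toMaybe k) j)

  card≡n : ∀ x → (∀ j → xv x nothing j + ∑ n (λ i → xv x (just i) j) ≡ 1) → card x ≡ n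
  -- The root's row and the other rows of card x together form a sum over Fin (suc n).
  card≡n x oneParent = begin
    card x                                           ≡⟨⟩
    ∑ (suc n) (λ k → ∑ n (xv x (toMaybe k)))         ≡⟨ ∑-comm (suc n) n (xv x ∘ toMaybe) ⟩
    ∑ n (λ j → ∑ (suc n) (λ k → xv x (toMaybe k) j)) ≡⟨ ∑-cong n oneParent ⟩
    ∑ n (λ _ → 1)                                    ≡⟨ ∑-const-1 n ⟩
    n                                                ∎
    where open ≡-Reasoning

  module WellFormedIntervals (wf : WellFormed) where

    l<r : ∀ j → l j < r j
    l<r = proj₁ wf

    l≉r : ∀ i j → ¬ (l i ≈ r j)
    l≉r i j = proj₂ (proj₂ (proj₂ wf i j))

    l∈I : ∀ j → l j ∈I j
    l∈I j = inj₂ Eq.refl , inj₁ (l<r j)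

    ⪯-sharing-point⇒≡ : ∀ {p j k} → p ∈I j → p ∈I k → j ⪯ k → j ≡ k
    ⪯-sharing-point⇒≡ _ _ (inj₁ j≡k) = j≡k
    ⪯-sharing-point⇒≡ (_ , p≦rj) (lk≦p , _) (inj₂ (inj₁ rj<lk)) =
      ⊥-elim (≦⇒≯ (≦-trans lk≦p p≦rj) rj<lk)
    ⪯-sharing-point⇒≡ {j = j} {k} _ _ (inj₂ (inj₂ rj≈lk)) = ⊥-elim (l≉r k j (Eq.sym rj≈lk))

    comparable⇔no-shared-endpoint : ∀ j k →
      (j ⪯ k ⊎ k ⪯ j) ⇔ (∀ p → IsEndpoint p → p ∈I j → p ∈I k → j ≡ k)
    comparable⇔no-shared-endpoint j k = mk⇔ disjoint comparable
      where
      disjoint : j ⪯ k ⊎ k ⪯ j → ∀ p → IsEndpoint p → p ∈I j → p ∈I k → j ≡ k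
      disjoint (inj₁ j⪯k) _ _ p∈Ij p∈Ik = ⪯-sharing-point⇒≡ p∈Ij p∈Ik j⪯k
      disjoint (inj₂ k⪯j) _ _ p∈Ij p∈Ik = sym (⪯-sharing-point⇒≡ p∈Ik p∈Ij k⪯j)

      comparable : (∀ p → IsEndpoint p → p ∈I j → p ∈I k → j ≡ k) → j ⪯ k ⊎ k ⪯ j
      comparable disjoint with ≦-total (l j) (l k)
      ... | inj₁ lj≦lk = [ inj₁ , (λ lk∈Ij → inj₁ (inj₁ (disjoint (l k) (k , inj₁ refl) lk∈Ij (l∈I k)))) ]
                           (⪯⊎l∈I j k lj≦lk)
      ... | inj₂ lk≦lj = [ inj₂ , (λ lj∈Ik → inj₁ (inj₁ (disjoint (l j) (j , inj₁ refl) (l∈I j) lj∈Ik))) ]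
                           (⪯⊎l∈I k j lk≦lj)

    antichain-common-endpoint : ∀ S → IsAntichain S → Nonempty S →
      ∃ λ p → IsEndpoint p × ∀ {j} → j ∈ₛ S → p ∈I j
    antichain-common-endpoint S antichain nonempty with ∃-maximal totalPreorder l S nonempty
    ... | m , m∈S , maximal = l m , (m , inj₁ refl) , λ {j} j∈S →
      [ (λ j⪯m → subst (l m ∈I_) (sym (antichain j m j∈S m∈S j⪯m)) (l∈I m)) , id ]
      (⪯⊎l∈I j m (maximal j∈S))

    IsChain : (Fin n → Set) → Set
    IsChain P = ∀ j k → P j → P k → j ⪯ k ⊎ k ⪯ j

    chain⇔ : ∀ x i → (∀ p → IsEndpoint p → Mx x (just i) p ≤ 1) ⇔ IsChain (Ch x (just i))
    chain⇔ x i = mk⇔ chain bound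
      where
      chain : (∀ p → IsEndpoint p → Mx x (just i) p ≤ 1) → IsChain (Ch x (just i))
      chain bounded j k j∈Ch k∈Ch = from (comparable⇔no-shared-endpoint j k) λ p endpoint p∈Ij p∈Ik →
        to ∣p∣≤1⇔ (subst (_≤ 1) (Mx≡∣childrenContaining∣ x (just i) p) (bounded p endpoint))
           (from (∈-childrenContaining x (just i) p) (p∈Ij , j∈Ch))
           (from (∈-childrenContaining x (just i) p) (p∈Ik , k∈Ch))

      bound : IsChain (Ch x (just i)) → ∀ p → IsEndpoint p → Mx x (just i) p ≤ 1
      bound isChain p endpoint = subst (_≤ 1) (sym (Mx≡∣childrenContaining∣ x (just i) p))
        (from (∣p∣≤1⇔ {p = childrenContaining x (just i) p}) λ j∈ k∈ →
          let p∈Ij , j∈Ch = to (∈-childrenContaining x (just i) p) j∈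
              p∈Ik , k∈Ch = to (∈-childrenContaining x (just i) p) k∈
          in to (comparable⇔no-shared-endpoint _ _) (isChain _ _ j∈Ch k∈Ch) p endpoint p∈Ij p∈Ik)

    C1⇔ : ∀ x → (∀ i → Bullet i → ∀ p → IsEndpoint p → Mx x (just i) p ≤ 1) ⇔ C1 x
    C1⇔ x = mk⇔
      (λ bounded i → inj₁ λ j k j∈Ch k∈Ch →
        to (chain⇔ x i) (bounded i (j , proj₁ j∈Ch)) j k j∈Ch k∈Ch)
      (λ c1 i _ → from (chain⇔ x i) ([ id , (λ childless j _ j∈Ch _ → ⊥-elim (childless j j∈Ch)) ] (c1 i)))

    C2⇔ : ∀ c x → (∀ p → IsEndpoint p → Mx x nothing p ≤ c) ⇔ C2 c x
    C2⇔ c x = mk⇔ antichainBound entryBound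
      where
      antichainBound : (∀ p → IsEndpoint p → Mx x nothing p ≤ c) → C2 c x
      antichainBound bounded S S⊆Ch antichain with nonempty? S
      ... | no ∅ = subst (_≤ c) (sym (Empty⇒∣p∣≡0 ∅)) z≤n
      ... | yes nonempty with antichain-common-endpoint S antichain nonempty
      ...   | p , endpoint , p∈I = ≤-trans
        (p⊆q⇒∣p∣≤∣q∣ (λ {j} j∈S → from (∈-childrenContaining x nothing p) (p∈I j∈S , S⊆Ch j j∈S)))
        (subst (_≤ c) (Mx≡∣childrenContaining∣ x nothing p) (bounded p endpoint))

      entryBound : C2 c x → ∀ p → IsEndpoint p → Mx x nothing p ≤ c
      entryBound c2 p _ = subst (_≤ c) (sym (Mx≡∣childrenContaining∣ x nothing p))
        (c2 (childrenContaining x nothing p) (λ _ → proj₂ ∘ to (∈-childrenContaining x nothing p))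
          λ _ _ j∈ k∈ → ⪯-sharing-point⇒≡ (proj₁ (to (∈-childrenContaining x nothing p) j∈))
                                          (proj₁ (to (∈-childrenContaining x nothing p) k∈)))

mainTheorem5 : (O : StrictTotalOrder 0ℓ 0ℓ 0ℓ) (n : ℕ)
               (l r : Fin n → StrictTotalOrder.Carrier O) →
               let open Setup O n l r in
               1 ≤ n → WellFormed → (c : ℕ) → 1 ≤ c → (x : ArcVec) →
               Constraints c x ⇔ (IsArborescence x × C1 x × C2 c x)
mainTheorem5 O n l r _ wf c _ x = mk⇔
  (λ (bounded , chains , oneParent) →
     (card≡n x oneParent , λ j → to (uniqueParent⇔ x j) (oneParent j)) ,
     to (C1⇔ x) chains , to (C2⇔ c x) bounded)
  (λ ((_ , uniqueParent) , c1 , c2) →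
     from (C2⇔ c x) c2 , from (C1⇔ x) c1 , λ j → from (uniqueParent⇔ x j) (uniqueParent j))
  where
  open Intervals O n l r
  open WellFormedIntervals wf
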